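{- Let $\mathbb{A}$ be a nonnegative tensor of order $m\ge 2$ and dimension $n$. (i) Let $k,l,i,j$ be positive integers with $1\le i,j\le n$. If $S_k(\mathbb{A},i)=S_l(\mathbb{A},j)$, then $S_{k+r}(\mathbb{A},i)=S_{l+r}(\mathbb{A},j)$ for every positive integer $r$. (ii) For $j\in[n]$, let $k$ be the least positive integer such that $S_k(\mathbb{A},j)=[n]$. Then $S_l(\mathbb{A},j)=[n]$ for every integer $l\ge k$.
   Context: A tensor of order $m$ and dimension $n$ is an array $\mathbb{A}=(a_{i_1\cdots i_m})$ with indices in $[n]=\{1,\dots,n\}$; nonnegative means all entries are nonnegative reals. For a dimension-$n$ tensor $\mathbb{A}$ of order $m\ge2$ and a dimension-$n$ tensor $\mathbb{B}$ of order $p\ge1$, the product $\mathbb{A}\mathbb{B}$ is the dimension-$n$ tensor $\mathbb{D}$ of order $(m-1)(p-1)+1$ with entries $d_{i\alpha_1\cdots\alpha_{m-1}}=\sum_{i_2,\dots,i_m=1}^n a_{ii_2\cdots i_m}b_{i_2\alpha_1}\cdots b_{i_m\alpha_{m-1}}$ for $i\in[n]$, $\alpha_1,\dots,\alpha_{m-1}\in[n]^{p-1}$ (this product is associative). Powers: $\mathbb{A}^1=\mathbb{A}$, $\mathbb{A}^{k+1}=\mathbb{A}\mathbb{A}^k$. The majorization matrix $M(\mathbb{B})$ of a dimension-$n$ tensor $\mathbb{B}$ of order $\ge2$ is the $n\times n$ matrix with $(M(\mathbb{B}))_{ij}=b_{ij\cdots j}$. For positive integers $k$ and $j\in[n]$,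 $S_k(\mathbb{A},j)=\{u\in[n]\mid (M(\mathbb{A}^k))_{uj}>0\}$. -}

module Defs where

open import Level using (Level; _⊔_) renaming (suc to lsuc)
open import Algebra.Bundles using (CommutativeSemiring)
open import Data.Nat as ℕ using (ℕ; zero; suc; _^_)
import Data.Nat.Properties as ℕP
open import Data.Fin using (Fin)
open import Data.Vec as V using (Vec; []; _∷_)
open import Data.List as L using (List)
open import Data.Product using (_×_; proj₁)
open import Data.Sum using (_⊎_)
open import Data.Empty using (⊥)
open import Function.Bundles using (_⇔_)
open import Relation.Nullary using (¬_)

-- An abstract model of the nonnegative-real arithmetic used in the paper:
-- a commutative semiring with relations ≤ and <, where "nonnegative" means
-- 0 ≤ a and "positive" means 0 < a, satisfying the positivity rules of ℝ
-- on nonnegative elements.  (ℝ with its usual order is an instance.)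
record OrderedSemiring (c ℓ : Level) : Set (lsuc (c ⊔ ℓ)) where
  field
    base : CommutativeSemiring c ℓ
  open CommutativeSemiring base public
  field
    _≤_ : Carrier → Carrier → Set ℓ
    _<_ : Carrier → Carrier → Set ℓ
    ≤-resp-≈ : ∀ {a b} → a ≈ b → 0# ≤ a → 0# ≤ b
    <-resp-≈ : ∀ {a b} → a ≈ b → 0# < a → 0# < b
    0≤0 : 0# ≤ 0#
    0≮0 : ¬ (0# < 0#)
    0≤1 : 0# ≤ 1#
    0<1 : 0# < 1#
    nonneg-+ : ∀ {a b} → 0# ≤ a → 0# ≤ b → 0# ≤ (a + b)
    nonneg-* : ∀ {a b} → 0# ≤ a → 0# ≤ b → 0# ≤ (a * b)
    pos-+ : ∀ {a b} → 0# ≤ a → 0# ≤ b → (0# < (a + b)) ⇔ (0# < a ⊎ 0# < b)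
    pos-* : ∀ {a b} → 0# ≤ a → 0# ≤ b → (0# < (a * b)) ⇔ (0# < a × 0# < b)

module Tensors {c ℓ} (R : OrderedSemiring c ℓ) (n : ℕ) where
  open OrderedSemiring R

  Tensor : ℕ → Set c
  Tensor m = Vec (Fin n) m → Carrier

  Nonnegative : ∀ {m} → Tensor m → Set ℓ
  Nonnegative A = ∀ idx → 0# ≤ A idx

  allVecs : (k : ℕ) → List (Vec (Fin n) k)
  allVecs zero = L.[ [] ]
  allVecs (suc k) = L.concatMap (λ i → L.map (i ∷_) (allVecs k)) (L.allFin n)

  sumL : List Carrier → Carrier
  sumL = L.foldr _+_ 0#

  prodV : ∀ {k} → Vec Carrier k → Carrier
  prodV = V.foldr _ _*_ 1#

  -- product of A (order suc m') and B (order suc p'); result order suc (m' * p')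
  -- (D)_{i α₁ … α_{m-1}} = Σ_{i₂…i_m} a_{i i₂ … i_m} b_{i₂ α₁} ⋯ b_{i_m α_{m-1}}
  mul : ∀ {m' p'} → Tensor (suc m') → Tensor (suc p') → Tensor (suc (m' ℕ.* p'))
  mul {m'} {p'} A B (i ∷ αs) =
    sumL (L.map (λ js → A (i ∷ js) *
                        prodV (V.zipWith (λ j α → B (j ∷ α)) js (proj₁ (V.group m' p' αs))))
                (allVecs m'))

  -- pow A k = A^(k+1), a tensor of order (m-1)^(k+1) + 1
  pow : ∀ {m'} → Tensor (suc m') → (k : ℕ) → Tensor (suc (m' ^ suc k))
  pow {m'} A zero idx = A (V.cast (cong-suc (ℕP.*-identityʳ m')) idx)
    where
      open import Relation.Binary.PropositionalEquality using (_≡_; cong)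
      cong-suc : ∀ {a b : ℕ} → a ≡ b → suc a ≡ suc b
      cong-suc = cong suc
  pow A (suc k) = mul A (pow A k)

  M : ∀ {p} → Tensor (suc p) → Fin n → Fin n → Carrier
  M {p} B i j = B (i ∷ V.replicate p j)

  -- S_k(A, j) as a predicate on u ∈ [n]; only meaningful for k ≥ 1
  -- (S 0 is set to the empty set by convention and never used).
  S : ∀ {m'} → Tensor (suc m') → ℕ → Fin n → Fin n → Set ℓ
  S A zero j u = Lift⊥
    where
      open import Level using (Lift)
      Lift⊥ = Lift ℓ ⊥
  S A (suc k) j u = 0# < M (pow A k) u j

  _≐_ : (Fin n → Set ℓ) → (Fin n → Set ℓ) → Set ℓ
  P ≐ Q = ∀ u → P u ⇔ Q u

  Full : (Fin n → Set ℓ) → Set ℓ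
  Full P = ∀ u → P u

module Submission where

-- Proof idea.  For a nonnegative tensor A of order m = m' + 1, positivity of
-- the majorization entries of the next power is governed by the previous one:
--
--   u ∈ S_{k+1}(A, j)  ⇔  a_{u i₂ ⋯ i_m} > 0 for some i₂, …, i_m ∈ S_k(A, j).
--
-- So S_{k+1}(A, j) = Reach (S_k(A, j)) for a fixed operator Reach on subsets
-- of [n] that does not depend on k or j.  Part (i) follows because Reach maps
-- equal sets to equal sets; part (ii) because Reach [n] ⊇ S_k(A, j) (every
-- element of S_k(A, j) indexes a row of A with a positive entry), so
-- S_k(A, j) = [n] implies S_{k+1}(A, j) = [n].

open import Defs
open import Data.Nat using (ℕ; zero; suc; _+_; _*_; _^_; _≤_; _<_; s≤s; _≤′_; ≤′-refl; ≤′-step)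
open import Data.Nat.Properties using (+-identityʳ; +-suc; *-identityʳ; ≤⇒≤′)
open import Data.Product using (_×_; ∃; _,_; proj₁; proj₂)
open import Data.Sum using (_⊎_; inj₁; inj₂)
open import Data.Empty using (⊥-elim)
open import Data.Fin using (Fin)
open import Data.Vec as V using (Vec; []; _∷_)
open import Data.Vec.Properties using (zipWith-replicate₂)
open import Data.Vec.Relation.Unary.All as All using (All; []; _∷_)
open import Data.Vec.Relation.Unary.All.Properties using (map⁺; map⁻)
import Data.List as L
open import Data.List.Properties using (map-cong)
open import Data.List.Relation.Unary.Any as Any using (Any; here; there)
open import Data.List.Relation.Unary.Any.Properties using (concatMap⁺) renaming (map⁺ to Any-map⁺)
open import Data.List.Membership.Propositional using (_∈_; lose)
open import Data.List.Membership.Propositional.Properties using (∈-allFin)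
open import Function.Bundles using (_⇔_; mk⇔; Equivalence)
import Function.Properties.Equivalence as ⇔
open import Relation.Nullary using (¬_)
open import Relation.Binary.PropositionalEquality
  using (_≡_; refl; cong; cong₂; subst; sym; trans)

open Equivalence using (to; from)

upward : ∀ {p} (P : ℕ → Set p) → (∀ t → P t → P (suc t)) →
         ∀ {k l} → k ≤ l → P k → P l
upward P step k≤l = go (≤⇒≤′ k≤l)
  where
    go : ∀ {k l} → k ≤′ l → P k → P l
    go ≤′-refl        pk = pk
    go (≤′-step k≤′l) pk = step _ (go k≤′l pk)

-- Splitting and grouping a constant vector yields constant pieces; this
-- computes the index vectors α₁, …, α_{m-1} in the product A·B at the
-- diagonal index (j, …, j) used by the majorization matrix.
splitAt-replicate : ∀ {a} {X : Set a} k r (x : X) →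
  V.take k (V.replicate (k + r) x) ≡ V.replicate k x ×
  V.drop k (V.replicate (k + r) x) ≡ V.replicate r x
splitAt-replicate zero    r x = refl , refl
splitAt-replicate (suc k) r x =
  cong (x ∷_) (proj₁ (splitAt-replicate k r x)) , proj₂ (splitAt-replicate k r x)

group-replicate : ∀ {a} {X : Set a} m k (x : X) →
  proj₁ (V.group m k (V.replicate (m * k) x)) ≡ V.replicate m (V.replicate k x)
group-replicate zero    k x = refl
group-replicate (suc m) k x =
  cong₂ _∷_ (proj₁ (splitAt-replicate k (m * k) x))
    (trans (cong (λ z → proj₁ (V.group m k z)) (proj₂ (splitAt-replicate k (m * k) x)))
           (group-replicate m k x))

module TensorPositivity {c ℓ} (R : OrderedSemiring c ℓ) (n : ℕ) where
  open OrderedSemiring R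
    using (Carrier; 0#; 0≤0; 0≮0; 0≤1; 0<1; nonneg-+; nonneg-*; pos-+; pos-*)
    renaming (_≤_ to _≤ᵣ_; _<_ to _<ᵣ_; _*_ to _*ᵣ_)
  open Tensors R n

  NonNeg Positive : Carrier → Set ℓ
  NonNeg a = 0# ≤ᵣ a
  Positive a = 0# <ᵣ a

  sum-nonneg : ∀ {a} {X : Set a} (f : X → Carrier) → (∀ x → NonNeg (f x)) →
               ∀ xs → NonNeg (sumL (L.map f xs))
  sum-nonneg f nn L.[]       = 0≤0
  sum-nonneg f nn (x L.∷ xs) = nonneg-+ (nn x) (sum-nonneg f nn xs)

  sum-pos⇔ : ∀ {a} {X : Set a} (f : X → Carrier) → (∀ x → NonNeg (f x)) →
             ∀ xs → Positive (sumL (L.map f xs)) ⇔ Any (λ x → Positive (f x)) xs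
  sum-pos⇔ f nn L.[]       = mk⇔ (λ p → ⊥-elim (0≮0 p)) (λ ())
  sum-pos⇔ f nn (x L.∷ xs) = mk⇔
    (λ p → head-or-tail (to (pos-+ (nn x) (sum-nonneg f nn xs)) p))
    (λ { (here q)  → from (pos-+ (nn x) (sum-nonneg f nn xs)) (inj₁ q)
       ; (there q) → from (pos-+ (nn x) (sum-nonneg f nn xs)) (inj₂ (from (sum-pos⇔ f nn xs) q)) })
    where
      head-or-tail : Positive (f x) ⊎ Positive (sumL (L.map f xs)) →
                     Any (λ x → Positive (f x)) (x L.∷ xs)
      head-or-tail (inj₁ q) = here q
      head-or-tail (inj₂ q) = there (to (sum-pos⇔ f nn xs) q)

  prod-nonneg : ∀ {k} {xs : Vec Carrier k} → All NonNeg xs → NonNeg (prodV xs)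
  prod-nonneg []         = 0≤1
  prod-nonneg (px ∷ pxs) = nonneg-* px (prod-nonneg pxs)

  prod-pos⇔ : ∀ {k} {xs : Vec Carrier k} → All NonNeg xs →
              Positive (prodV xs) ⇔ All Positive xs
  prod-pos⇔ []         = mk⇔ (λ _ → []) (λ _ → 0<1)
  prod-pos⇔ (px ∷ pxs) = mk⇔
    (λ p → let q = to (pos-* px (prod-nonneg pxs)) p
           in proj₁ q ∷ to (prod-pos⇔ pxs) (proj₂ q))
    (λ { (q ∷ qs) → from (pos-* px (prod-nonneg pxs)) (q , from (prod-pos⇔ pxs) qs) })

  allVecs-complete : ∀ k (v : Vec (Fin n) k) → v ∈ allVecs k
  allVecs-complete zero    []      = here refl
  allVecs-complete (suc k) (x ∷ v) =
    concatMap⁺ (λ i → L.map (i ∷_) (allVecs k))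
      (lose (∈-allFin x) (Any-map⁺ (Any.map (cong (x ∷_)) (allVecs-complete k v))))

  sum-allVecs-pos⇔ : ∀ {k} (f : Vec (Fin n) k → Carrier) → (∀ v → NonNeg (f v)) →
    Positive (sumL (L.map f (allVecs k))) ⇔ ∃ λ v → Positive (f v)
  sum-allVecs-pos⇔ {k} f nn = mk⇔
    (λ p → Any.satisfied (to (sum-pos⇔ f nn (allVecs k)) p))
    (λ { (v , q) → from (sum-pos⇔ f nn (allVecs k)) (lose (allVecs-complete k v) q) })

  factors-nonneg : ∀ {p} {B : Tensor (suc p)} → Nonnegative B →
    ∀ {k} (js : Vec (Fin n) k) zs → All NonNeg (V.zipWith (λ a α → B (a ∷ α)) js zs)
  factors-nonneg nnB []       []       = []
  factors-nonneg nnB (a ∷ js) (z ∷ zs) = nnB _ ∷ factors-nonneg nnB js zs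

  module _ {m'} (A : Tensor (suc m')) (nnA : Nonnegative A) where

    pow-nonneg : ∀ k → Nonnegative (pow A k)
    pow-nonneg zero    idx      = nnA _
    pow-nonneg (suc k) (i ∷ αs) = sum-nonneg _
      (λ js → nonneg-* (nnA _) (prod-nonneg (factors-nonneg (pow-nonneg k) js _))) (allVecs m')

    Reach : (Fin n → Set ℓ) → Fin n → Set ℓ
    Reach P u = ∃ λ (js : Vec (Fin n) m') → Positive (A (u ∷ js)) × All P js

    Reach-cong : ∀ {P Q} → P ≐ Q → Reach P ≐ Reach Q
    Reach-cong P≐Q u = mk⇔
      (λ { (js , a , ps) → js , a , All.map (λ {v} → to (P≐Q v)) ps })
      (λ { (js , a , qs) → js , a , All.map (λ {v} → from (P≐Q v)) qs })

    M-pow-suc : ∀ k u j →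
      M (pow A (suc k)) u j ≡
      sumL (L.map (λ js → A (u ∷ js) *ᵣ prodV (V.map (λ v → M (pow A k) v j) js)) (allVecs m'))
    M-pow-suc k u j = trans
      (cong (λ zs → sumL (L.map (λ js → A (u ∷ js) *ᵣ prodV (V.zipWith B js zs)) (allVecs m')))
            (group-replicate m' p j))
      (cong sumL (map-cong (λ js → cong (λ xs → A (u ∷ js) *ᵣ prodV xs)
                                        (zipWith-replicate₂ B js (V.replicate p j)))
                           (allVecs m')))
      where
        p : ℕ
        p = m' ^ suc k
        B : Fin n → Vec (Fin n) p → Carrier
        B a α = pow A k (a ∷ α)

    S-suc : ∀ k j → S A (suc (suc k)) j ≐ Reach (S A (suc k) j)
    S-suc k j u = mk⇔
      (λ h → let js , q = to (sum-allVecs-pos⇔ _ term-nonneg) (subst Positive (M-pow-suc k u j) h)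
                 a , ps = to (pos-* (nnA _) (prod-nonneg (column-nonneg js))) q
             in js , a , map⁻ (to (prod-pos⇔ (column-nonneg js)) ps))
      (λ { (js , a , ps) → subst Positive (sym (M-pow-suc k u j))
             (from (sum-allVecs-pos⇔ _ term-nonneg)
               (js , from (pos-* (nnA _) (prod-nonneg (column-nonneg js)))
                          (a , from (prod-pos⇔ (column-nonneg js)) (map⁺ ps)))) })
      where
        column-nonneg : ∀ js → All NonNeg (V.map (λ v → M (pow A k) v j) js)
        column-nonneg js = map⁺ (All.universal (λ v → pow-nonneg k _) js)
        term-nonneg : ∀ js → NonNeg (A (u ∷ js) *ᵣ prodV (V.map (λ v → M (pow A k) v j) js))
        term-nonneg js = nonneg-* (nnA _) (prod-nonneg (column-nonneg js))

    S-step : ∀ k l i j → S A (suc k) i ≐ S A (suc l) j →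
             S A (suc (suc k)) i ≐ S A (suc (suc l)) j
    S-step k l i j e u =
      ⇔.trans (S-suc k i u) (⇔.trans (Reach-cong e u) (⇔.sym (S-suc l j u)))

    S-shift : ∀ k l i j → S A (suc k) i ≐ S A (suc l) j →
              ∀ r → S A (suc (k + r)) i ≐ S A (suc (l + r)) j
    S-shift k l i j e zero    rewrite +-identityʳ k | +-identityʳ l = e
    S-shift k l i j e (suc r) rewrite +-suc k r     | +-suc l r     =
      S-step (k + r) (l + r) i j (S-shift k l i j e r)

    -- Part (ii): every element of S_{k+1}(A, j) indexes a row of A with a
    -- positive entry, so Reach [n] contains S_{k+1}(A, j) and fullness of S
    -- propagates to all larger exponents.
    S⇒positive-row : ∀ k j u → S A (suc k) j u → ∃ λ js → Positive (A (u ∷ js))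
    S⇒positive-row zero    j u h = V.cast (*-identityʳ m') (V.replicate (m' ^ 1) j) , h
    S⇒positive-row (suc k) j u h with to (S-suc k j u) h
    ... | js , a , _ = js , a

    full-step : ∀ k j → Full (S A (suc k) j) → Full (S A (suc (suc k)) j)
    full-step k j full u =
      let js , a = S⇒positive-row k j u (full u)
      in from (S-suc k j u) (js , a , All.universal full js)

    full-upward : ∀ {k l} j → k ≤ l → Full (S A (suc k) j) → Full (S A (suc l) j)
    full-upward j = upward (λ t → Full (S A (suc t) j)) (λ t → full-step t j)

-- Lemma 3.1.  Exponents are at least 1, so they have the form suc k.
lemma3p1 : ∀ {c ℓ} (R : OrderedSemiring c ℓ) (n m' : ℕ) →
    let open Tensors R n in
    (A : Tensor (suc m')) → 1 ≤ m' → Nonnegative A →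
      (∀ (k l : ℕ) (i j : Fin n) → 1 ≤ k → 1 ≤ l →
        S A k i ≐ S A l j →
        ∀ (r : ℕ) → 1 ≤ r → S A (k + r) i ≐ S A (l + r) j)
      ×
      (∀ (j : Fin n) (k : ℕ) → 1 ≤ k → Full (S A k j) →
        (∀ k' → 1 ≤ k' → k' < k → ¬ Full (S A k' j)) →
        ∀ (l : ℕ) → k ≤ l → Full (S A l j))
lemma3p1 R n m' A _ nnA =
    (λ { (suc k) (suc l) i j _ _ Sk≐Sl r _ → S-shift A nnA k l i j Sk≐Sl r })
  , (λ { j (suc k) _ full _ (suc l) (s≤s k≤l) → full-upward A nnA j k≤l full })
  where open TensorPositivity R n
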